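{- Simple type theory (as defined in the context) is super-consistent: for every full, ordered and complete truth values algebra $\mathcal B$, it has a $\mathcal B$-valued model.
   Context: Simple type theory is the following many-sorted theory in deduction modulo (no axioms). Sorts: $\iota$ and $o$ are sorts, and if $T,U$ are sorts then $T\to U$ is a sort. Constants: $S_{T,U,V}$ of sort $(T\to U\to V)\to(T\to U)\to T\to V$, $K_{T,U}$ of sort $T\to U\to T$, $\dot\top,\dot\bot$ of sort $o$, $\dot\Rightarrow,\dot\wedge,\dot\vee$ of sort $o\to o\to o$, $\dot\forall_T,\dot\exists_T$ of sort $(T\to o)\to o$; function symbols $\alpha_{T,U}$ of rank $\langle T\to U,T,U\rangle$; predicate symbol $\varepsilon$ of rank $\langle o\rangle$. Rewrite rules: $\alpha(\alpha(\alpha(S_{T,U,V},x),y),z)\longrightarrow\alpha(\alpha(x,z),\alpha(y,z))$; $\alpha(\alpha(K_{T,U},x),y)\longrightarrow x$; $\varepsilon(\dot\top)\longrightarrow\top$; $\varepsilon(\dot\bot)\longrightarrow\bot$; $\varepsilon(\alpha(\alpha(\dot\Rightarrow,x),y))\longrightarrow\varepsilon(x)\Rightarrow\varepsilon(y)$; same for $\dot\wedge,\dot\vee$ with $\wedge,\vee$; $\varepsilon(\alpha(\dot\forall_T,x))\longrightarrow\forall y\,\varepsilon(\alpha(x,y))$; $\varepsilon(\alpha(\dot\exists_T,x))\longrightarrow\exists y\,\varepsilon(\alpha(x,y))$. Truth values algebra: a structure $\langle \mathcal B,\mathcal B^+,\mathcal A,\mathcal E,\tilde\top,\tilde\bot,\tilde\Rightarrow,\tilde\wedge,\tilde\vee,\tilde\forall,\tilde\exists\rangle$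 with $\mathcal B$ a set, $\mathcal B^+\subseteq\mathcal B$, $\mathcal A,\mathcal E\subseteq\wp(\mathcal B)$, $\tilde\top,\tilde\bot\in\mathcal B$, binary $\tilde\Rightarrow,\tilde\wedge,\tilde\vee$ on $\mathcal B$, $\tilde\forall:\mathcal A\to\mathcal B$, $\tilde\exists:\mathcal E\to\mathcal B$, such that $\mathcal B^+$ is closed under the intuitionistic deduction rules, i.e. for all $a,b,c$, $A\in\mathcal A$, $E\in\mathcal E$: (1) $a\tilde\Rightarrow b,a\in\mathcal B^+\Rightarrow b\in\mathcal B^+$; (2) $a\tilde\Rightarrow b\tilde\Rightarrow a\in\mathcal B^+$; (3) $(a\tilde\Rightarrow b\tilde\Rightarrow c)\tilde\Rightarrow(a\tilde\Rightarrow b)\tilde\Rightarrow a\tilde\Rightarrow c\in\mathcal B^+$; (4) $\tilde\top\in\mathcal B^+$; (5) $\tilde\bot\tilde\Rightarrow a\in\mathcal B^+$; (6) $a\tilde\Rightarrow b\tilde\Rightarrow(a\tilde\wedge b)\in\mathcal B^+$; (7),(8) $(a\tilde\wedge b)\tilde\Rightarrow a$, $(a\tilde\wedge b)\tilde\Rightarrow b\in\mathcal B^+$; (9),(10) $a\tilde\Rightarrow(a\tilde\vee b)$, $b\tilde\Rightarrow(a\tilde\vee b)\in\mathcal B^+$; (11) $(a\tilde\vee b)\tilde\Rightarrow(a\tilde\Rightarrow c)\tilde\Rightarrow(b\tilde\Rightarrow c)\tilde\Rightarrow c\in\mathcal B^+$; (12) $\{a\tilde\Rightarrow e\mid e\in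 A\},\{e\tilde\Rightarrow a\mid e\in E\}\in\mathcal A$; (13) $A\subseteq\mathcal B^+\Rightarrow\tilde\forall A\in\mathcal B^+$; (14) $\tilde\forall\{a\tilde\Rightarrow e\mid e\in A\}\tilde\Rightarrow a\tilde\Rightarrow\tilde\forall A\in\mathcal B^+$; (15) $a\in A\Rightarrow(\tilde\forall A)\tilde\Rightarrow a\in\mathcal B^+$; (16) $a\in E\Rightarrow a\tilde\Rightarrow\tilde\exists E\in\mathcal B^+$; (17) $(\tilde\exists E)\tilde\Rightarrow\tilde\forall\{e\tilde\Rightarrow a\mid e\in E\}\tilde\Rightarrow a\in\mathcal B^+$. Full: $\mathcal A=\mathcal E=\wp(\mathcal B)$. Ordered: with an order $\sqsubseteq$ such that $\mathcal B^+$ is upward closed, $\tilde\top$ maximal, $\tilde\wedge,\tilde\vee,\tilde\forall,\tilde\exists$ monotone, $\tilde\Rightarrow$ anti-monotone left and monotone right. Complete: every subset has a $\sqsubseteq$-greatest lower bound. Models in deduction modulo: a $\mathcal B$-valued structure gives a domain $\mathcal M_T$ for each sort, functions for function symbols (constants are elements) and $\mathcal B$-valued functions for predicate symbols; denotations are compositional with $\llbracket\forall x A\rrbracket_\phi=\tilde\forall\{\llbracket A\rrbracket_{\phi+\langle x,e\rangle}\mid e\in\mathcal M_T\}$ and similarly for $\exists$. It is a model of a theory without axioms and with congruence $\equiv$ if for all terms or formulae $A\equiv B$ and all assignments $\phi$, $\llbracket A\rrbracket_\phi$ and $\llbracket B\rrbracket_\phi$ are defined and equal. A theory is super-consistent if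 it has a $\mathcal B$-valued model for every full, ordered and complete truth values algebra $\mathcal B$. -}

module Defs where

open import Level using (Level; _⊔_) renaming (suc to lsuc)
open import Data.Product using (Σ; _×_; _,_)
open import Data.List using (List; []; _∷_)
open import Relation.Binary.PropositionalEquality using (_≡_)

module _ {ℓ : Level} {B : Set ℓ} where
  Img : (B → Set ℓ) → (B → B) → (B → Set ℓ)
  Img P f x = Σ B λ e → P e × (x ≡ f e)

  Fam : {I : Set ℓ} → (I → B) → (B → Set ℓ)
  Fam {I} f x = Σ I λ i → x ≡ f i

-- A full truth values algebra: 𝒜 = ℰ = ℘(B), so ∀̃, ∃̃ are defined on
-- all subsets and condition (12) holds trivially.
record FullTVA (ℓ : Level) : Set (lsuc ℓ) where
  infixr 5 _⇒̃_
  infixr 6 _∧̃_ _∨̃_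
  field
    Carrier : Set ℓ
    B⁺      : Carrier → Set ℓ
    ⊤̃ ⊥̃     : Carrier
    _⇒̃_ _∧̃_ _∨̃_ : Carrier → Carrier → Carrier
    ∀̃ ∃̃    : (Carrier → Set ℓ) → Carrier
    -- subsets are extensional (artifact of representing sets as predicates)
    ∀̃-ext : (P Q : Carrier → Set ℓ) →
            (∀ x → P x → Q x) → (∀ x → Q x → P x) → ∀̃ P ≡ ∀̃ Q
    ∃̃-ext : (P Q : Carrier → Set ℓ) →
            (∀ x → P x → Q x) → (∀ x → Q x → P x) → ∃̃ P ≡ ∃̃ Q
    c1  : ∀ a b → B⁺ (a ⇒̃ b) → B⁺ a → B⁺ b
    c2  : ∀ a b → B⁺ (a ⇒̃ b ⇒̃ a)
    c3  : ∀ a b c → B⁺ ((a ⇒̃ b ⇒̃ c) ⇒̃ (a ⇒̃ b) ⇒̃ a ⇒̃ c)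
    c4  : B⁺ ⊤̃
    c5  : ∀ a → B⁺ (⊥̃ ⇒̃ a)
    c6  : ∀ a b → B⁺ (a ⇒̃ b ⇒̃ (a ∧̃ b))
    c7  : ∀ a b → B⁺ ((a ∧̃ b) ⇒̃ a)
    c8  : ∀ a b → B⁺ ((a ∧̃ b) ⇒̃ b)
    c9  : ∀ a b → B⁺ (a ⇒̃ (a ∨̃ b))
    c10 : ∀ a b → B⁺ (b ⇒̃ (a ∨̃ b))
    c11 : ∀ a b c → B⁺ ((a ∨̃ b) ⇒̃ (a ⇒̃ c) ⇒̃ (b ⇒̃ c) ⇒̃ c)
    c13 : ∀ (A : Carrier → Set ℓ) → (∀ x → A x → B⁺ x) → B⁺ (∀̃ A)
    c14 : ∀ a (A : Carrier → Set ℓ) →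
          B⁺ (∀̃ (Img A (λ e → a ⇒̃ e)) ⇒̃ a ⇒̃ ∀̃ A)
    c15 : ∀ a (A : Carrier → Set ℓ) → A a → B⁺ (∀̃ A ⇒̃ a)
    c16 : ∀ a (E : Carrier → Set ℓ) → E a → B⁺ (a ⇒̃ ∃̃ E)
    c17 : ∀ a (E : Carrier → Set ℓ) →
          B⁺ (∃̃ E ⇒̃ ∀̃ (Img E (λ e → e ⇒̃ a)) ⇒̃ a)

record FOCTVA (ℓ : Level) : Set (lsuc ℓ) where
  field
    tva : FullTVA ℓ
  open FullTVA tva
  field
    _⊑_      : Carrier → Carrier → Set ℓ
    ⊑-refl   : ∀ a → a ⊑ a
    ⊑-trans  : ∀ a b c → a ⊑ b → b ⊑ c → a ⊑ c
    ⊑-antisym : ∀ a b → a ⊑ b → b ⊑ a → a ≡ b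
    B⁺-up    : ∀ a b → B⁺ a → a ⊑ b → B⁺ b
    ⊤̃-max    : ∀ a → ⊤̃ ⊑ a → a ≡ ⊤̃
    ∧̃-mono   : ∀ a a' b b' → a ⊑ a' → b ⊑ b' → (a ∧̃ b) ⊑ (a' ∧̃ b')
    ∨̃-mono   : ∀ a a' b b' → a ⊑ a' → b ⊑ b' → (a ∨̃ b) ⊑ (a' ∨̃ b')
    ⇒̃-mono   : ∀ a a' b b' → a' ⊑ a → b ⊑ b' → (a ⇒̃ b) ⊑ (a' ⇒̃ b')
    ∀̃-mono   : (I : Set ℓ) (f g : I → Carrier) → (∀ i → f i ⊑ g i) →
               ∀̃ (Fam f) ⊑ ∀̃ (Fam g)
    ∃̃-mono   : (I : Set ℓ) (f g : I → Carrier) → (∀ i → f i ⊑ g i) →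
               ∃̃ (Fam f) ⊑ ∃̃ (Fam g)
    glb      : (P : Carrier → Set ℓ) →
               Σ Carrier λ m → (∀ x → P x → m ⊑ x) ×
                               (∀ c → (∀ x → P x → c ⊑ x) → c ⊑ m)

infixr 7 _⇛_
data Sort : Set where
  ι o  : Sort
  _⇛_ : Sort → Sort → Sort

Ctx : Set
Ctx = List Sort

data Var : Ctx → Sort → Set where
  vz : ∀ {Γ T} → Var (T ∷ Γ) T
  vs : ∀ {Γ T U} → Var Γ T → Var (U ∷ Γ) T

data Const : Sort → Set where
  S  : ∀ T U V → Const ((T ⇛ U ⇛ V) ⇛ (T ⇛ U) ⇛ T ⇛ V)
  K  : ∀ T U → Const (T ⇛ U ⇛ T)
  ⊤̇ ⊥̇ : Const o
  ⇒̇ ∧̇ ∨̇ : Const (o ⇛ o ⇛ o)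
  ∀̇ ∃̇ : ∀ T → Const ((T ⇛ o) ⇛ o)

data Term (Γ : Ctx) : Sort → Set where
  var : ∀ {T} → Var Γ T → Term Γ T
  con : ∀ {T} → Const T → Term Γ T
  α   : ∀ {T U} → Term Γ (T ⇛ U) → Term Γ T → Term Γ U

data Form (Γ : Ctx) : Set where
  ε       : Term Γ o → Form Γ
  ⊤ ⊥     : Form Γ
  _⇒_ _∧_ _∨_ : Form Γ → Form Γ → Form Γ
  ∀[_] ∃[_] : (T : Sort) → Form (T ∷ Γ) → Form Γ

rename : ∀ {Γ Δ T} → (∀ {U} → Var Γ U → Var Δ U) → Term Γ T → Term Δ T
rename ρ (var x) = var (ρ x)
rename ρ (con c) = con c
rename ρ (α t u) = α (rename ρ t) (rename ρ u)

wk : ∀ {Γ T U} → Term Γ T → Term (U ∷ Γ) T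
wk = rename vs

data _≈t_ {Γ : Ctx} : ∀ {T} → Term Γ T → Term Γ T → Set where
  ruleS : ∀ {T U V} (x : Term Γ (T ⇛ U ⇛ V)) (y : Term Γ (T ⇛ U)) (z : Term Γ T) →
          α (α (α (con (S T U V)) x) y) z ≈t α (α x z) (α y z)
  ruleK : ∀ {T U} (x : Term Γ T) (y : Term Γ U) →
          α (α (con (K T U)) x) y ≈t x
  t-refl  : ∀ {T} {t : Term Γ T} → t ≈t t
  t-sym   : ∀ {T} {t u : Term Γ T} → t ≈t u → u ≈t t
  t-trans : ∀ {T} {t u v : Term Γ T} → t ≈t u → u ≈t v → t ≈t v
  α-cong  : ∀ {T U} {t t' : Term Γ (T ⇛ U)} {u u' : Term Γ T} →
            t ≈t t' → u ≈t u' → α t u ≈t α t' u'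

data _≈f_ : ∀ {Γ} → Form Γ → Form Γ → Set where
  rule⊤ : ∀ {Γ} → ε {Γ} (con ⊤̇) ≈f ⊤
  rule⊥ : ∀ {Γ} → ε {Γ} (con ⊥̇) ≈f ⊥
  rule⇒ : ∀ {Γ} (x y : Term Γ o) → ε (α (α (con ⇒̇) x) y) ≈f (ε x ⇒ ε y)
  rule∧ : ∀ {Γ} (x y : Term Γ o) → ε (α (α (con ∧̇) x) y) ≈f (ε x ∧ ε y)
  rule∨ : ∀ {Γ} (x y : Term Γ o) → ε (α (α (con ∨̇) x) y) ≈f (ε x ∨ ε y)
  rule∀ : ∀ {Γ T} (x : Term Γ (T ⇛ o)) →
          ε (α (con (∀̇ T)) x) ≈f ∀[ T ] (ε (α (wk x) (var vz)))
  rule∃ : ∀ {Γ T} (x : Term Γ (T ⇛ o)) →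
          ε (α (con (∃̇ T)) x) ≈f ∃[ T ] (ε (α (wk x) (var vz)))
  f-refl  : ∀ {Γ} {A : Form Γ} → A ≈f A
  f-sym   : ∀ {Γ} {A B : Form Γ} → A ≈f B → B ≈f A
  f-trans : ∀ {Γ} {A B C : Form Γ} → A ≈f B → B ≈f C → A ≈f C
  ε-cong  : ∀ {Γ} {t u : Term Γ o} → t ≈t u → ε t ≈f ε u
  ⇒-cong  : ∀ {Γ} {A A' B B' : Form Γ} → A ≈f A' → B ≈f B' → (A ⇒ B) ≈f (A' ⇒ B')
  ∧-cong  : ∀ {Γ} {A A' B B' : Form Γ} → A ≈f A' → B ≈f B' → (A ∧ B) ≈f (A' ∧ B')
  ∨-cong  : ∀ {Γ} {A A' B B' : Form Γ} → A ≈f A' → B ≈f B' → (A ∨ B) ≈f (A' ∨ B')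
  ∀-cong  : ∀ {Γ T} {A A' : Form (T ∷ Γ)} → A ≈f A' → ∀[ T ] A ≈f ∀[ T ] A'
  ∃-cong  : ∀ {Γ T} {A A' : Form (T ∷ Γ)} → A ≈f A' → ∃[ T ] A ≈f ∃[ T ] A'

record Structure {ℓ : Level} (𝔹 : FullTVA ℓ) : Set (lsuc ℓ) where
  open FullTVA 𝔹
  field
    Dom : Sort → Set ℓ
    ⟦con⟧ : ∀ {T} → Const T → Dom T
    ⟦α⟧   : ∀ {T U} → Dom (T ⇛ U) → Dom T → Dom U
    ⟦ε⟧   : Dom o → Carrier

  Env : Ctx → Set ℓ
  Env Γ = ∀ {T} → Var Γ T → Dom T

  extend : ∀ {Γ T} → Env Γ → Dom T → Env (T ∷ Γ)
  extend φ e vz     = e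
  extend φ e (vs x) = φ x

  ⟦_⟧t : ∀ {Γ T} → Term Γ T → Env Γ → Dom T
  ⟦ var x ⟧t φ = φ x
  ⟦ con c ⟧t φ = ⟦con⟧ c
  ⟦ α t u ⟧t φ = ⟦α⟧ (⟦ t ⟧t φ) (⟦ u ⟧t φ)

  ⟦_⟧f : ∀ {Γ} → Form Γ → Env Γ → Carrier
  ⟦ ε t ⟧f φ = ⟦ε⟧ (⟦ t ⟧t φ)
  ⟦ ⊤ ⟧f φ = ⊤̃
  ⟦ ⊥ ⟧f φ = ⊥̃
  ⟦ A ⇒ B ⟧f φ = ⟦ A ⟧f φ ⇒̃ ⟦ B ⟧f φ
  ⟦ A ∧ B ⟧f φ = ⟦ A ⟧f φ ∧̃ ⟦ B ⟧f φ
  ⟦ A ∨ B ⟧f φ = ⟦ A ⟧f φ ∨̃ ⟦ B ⟧f φ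
  ⟦ ∀[ T ] A ⟧f φ = ∀̃ (Fam {I = Dom T} λ e → ⟦ A ⟧f (extend φ e))
  ⟦ ∃[ T ] A ⟧f φ = ∃̃ (Fam {I = Dom T} λ e → ⟦ A ⟧f (extend φ e))

record Model {ℓ : Level} (𝔹 : FullTVA ℓ) : Set (lsuc ℓ) where
  field
    structure : Structure 𝔹
  open Structure structure
  field
    sound-t : ∀ {Γ T} {t u : Term Γ T} → t ≈t u → ∀ (φ : Env Γ) → ⟦ t ⟧t φ ≡ ⟦ u ⟧t φ
    sound-f : ∀ {Γ} {A B : Form Γ} → A ≈f B → ∀ (φ : Env Γ) → ⟦ A ⟧f φ ≡ ⟦ B ⟧f φ

SuperConsistentSTT : (ℓ : Level) → Set (lsuc ℓ)
SuperConsistentSTT ℓ = (𝔹 : FOCTVA ℓ) → Model (FOCTVA.tva 𝔹)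

{-# OPTIONS --safe #-}
module Submission where

open import Defs
open import Level using (Level)
open import Data.Unit.Polymorphic using () renaming (⊤ to Unit)
open import Data.Product using (_,_)
open import Relation.Binary.PropositionalEquality

-- Interpret ι as a singleton, o as the algebra itself and T ⇛ U as the
-- full function space.  Then S, K and the connective rules hold by
-- computation, and only the quantifier rules need an argument: weakening
-- does not change denotations, and ∀̃, ∃̃ only see the image of a family.

module FullFunctionModel {ℓ : Level} (𝔹 : FullTVA ℓ) where
  open FullTVA 𝔹

  Fam-⊆ : {I : Set ℓ} {f g : I → Carrier} → (∀ i → f i ≡ g i) →
          ∀ x → Fam f x → Fam g x
  Fam-⊆ f≗g x (i , x≡fi) = i , trans x≡fi (f≗g i)

  ∀̃-Fam-cong : {I : Set ℓ} {f g : I → Carrier} → (∀ i → f i ≡ g i) →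
               ∀̃ (Fam f) ≡ ∀̃ (Fam g)
  ∀̃-Fam-cong f≗g = ∀̃-ext _ _ (Fam-⊆ f≗g) (Fam-⊆ (λ i → sym (f≗g i)))

  ∃̃-Fam-cong : {I : Set ℓ} {f g : I → Carrier} → (∀ i → f i ≡ g i) →
               ∃̃ (Fam f) ≡ ∃̃ (Fam g)
  ∃̃-Fam-cong f≗g = ∃̃-ext _ _ (Fam-⊆ f≗g) (Fam-⊆ (λ i → sym (f≗g i)))

  Dom : Sort → Set ℓ
  Dom ι       = Unit
  Dom o       = Carrier
  Dom (T ⇛ U) = Dom T → Dom U

  ⟦_⟧c : ∀ {T} → Const T → Dom T
  ⟦ S T U V ⟧c = λ x y z → x z (y z)
  ⟦ K T U ⟧c   = λ x y → x
  ⟦ ⊤̇ ⟧c       = ⊤̃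
  ⟦ ⊥̇ ⟧c       = ⊥̃
  ⟦ ⇒̇ ⟧c       = _⇒̃_
  ⟦ ∧̇ ⟧c       = _∧̃_
  ⟦ ∨̇ ⟧c       = _∨̃_
  ⟦ ∀̇ T ⟧c     = λ f → ∀̃ (Fam f)
  ⟦ ∃̇ T ⟧c     = λ f → ∃̃ (Fam f)

  structure : Structure 𝔹
  structure = record
    { Dom = Dom ; ⟦con⟧ = ⟦_⟧c ; ⟦α⟧ = λ f x → f x ; ⟦ε⟧ = λ b → b }

  open Structure structure hiding (Dom)

  ⟦rename⟧t : ∀ {Γ Δ T} (ρ : ∀ {U} → Var Γ U → Var Δ U) (t : Term Γ T)
              {ψ : Env Δ} {φ : Env Γ} → (∀ {U} (x : Var Γ U) → ψ (ρ x) ≡ φ x) →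
              ⟦ rename ρ t ⟧t ψ ≡ ⟦ t ⟧t φ
  ⟦rename⟧t ρ (var x) ψρ≗φ = ψρ≗φ x
  ⟦rename⟧t ρ (con c) ψρ≗φ = refl
  ⟦rename⟧t ρ (α t u) ψρ≗φ =
    cong₂ (λ f x → f x) (⟦rename⟧t ρ t ψρ≗φ) (⟦rename⟧t ρ u ψρ≗φ)

  ⟦wk⟧t : ∀ {Γ T U} (t : Term Γ T) (φ : Env Γ) (e : Dom U) →
          ⟦ wk t ⟧t (extend φ e) ≡ ⟦ t ⟧t φ
  ⟦wk⟧t {U = U} t φ e = ⟦rename⟧t (vs {U = U}) t (λ x → refl)

  ⟦⟧t-sound : ∀ {Γ T} {t u : Term Γ T} → t ≈t u → (φ : Env Γ) → ⟦ t ⟧t φ ≡ ⟦ u ⟧t φ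
  ⟦⟧t-sound (ruleS x y z) φ = refl
  ⟦⟧t-sound (ruleK x y)   φ = refl
  ⟦⟧t-sound t-refl        φ = refl
  ⟦⟧t-sound (t-sym p)     φ = sym (⟦⟧t-sound p φ)
  ⟦⟧t-sound (t-trans p q) φ = trans (⟦⟧t-sound p φ) (⟦⟧t-sound q φ)
  ⟦⟧t-sound (α-cong p q)  φ = cong₂ (λ f x → f x) (⟦⟧t-sound p φ) (⟦⟧t-sound q φ)

  ⟦⟧f-sound : ∀ {Γ} {A B : Form Γ} → A ≈f B → (φ : Env Γ) → ⟦ A ⟧f φ ≡ ⟦ B ⟧f φ
  ⟦⟧f-sound rule⊤         φ = refl
  ⟦⟧f-sound rule⊥         φ = refl
  ⟦⟧f-sound (rule⇒ x y)   φ = refl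
  ⟦⟧f-sound (rule∧ x y)   φ = refl
  ⟦⟧f-sound (rule∨ x y)   φ = refl
  ⟦⟧f-sound (rule∀ {T = T} x) φ = ∀̃-Fam-cong λ e → cong (λ f → f e) (sym (⟦wk⟧t {U = T} x φ e))
  ⟦⟧f-sound (rule∃ {T = T} x) φ = ∃̃-Fam-cong λ e → cong (λ f → f e) (sym (⟦wk⟧t {U = T} x φ e))
  ⟦⟧f-sound f-refl        φ = refl
  ⟦⟧f-sound (f-sym p)     φ = sym (⟦⟧f-sound p φ)
  ⟦⟧f-sound (f-trans p q) φ = trans (⟦⟧f-sound p φ) (⟦⟧f-sound q φ)
  ⟦⟧f-sound (ε-cong p)    φ = ⟦⟧t-sound p φ
  ⟦⟧f-sound (⇒-cong p q)  φ = cong₂ _⇒̃_ (⟦⟧f-sound p φ) (⟦⟧f-sound q φ)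
  ⟦⟧f-sound (∧-cong p q)  φ = cong₂ _∧̃_ (⟦⟧f-sound p φ) (⟦⟧f-sound q φ)
  ⟦⟧f-sound (∨-cong p q)  φ = cong₂ _∨̃_ (⟦⟧f-sound p φ) (⟦⟧f-sound q φ)
  ⟦⟧f-sound (∀-cong p)    φ = ∀̃-Fam-cong λ e → ⟦⟧f-sound p (extend φ e)
  ⟦⟧f-sound (∃-cong p)    φ = ∃̃-Fam-cong λ e → ⟦⟧f-sound p (extend φ e)

  model : Model 𝔹
  model = record { structure = structure ; sound-t = ⟦⟧t-sound ; sound-f = ⟦⟧f-sound }

mainTheorem14 : ∀ {ℓ : Level} → (𝔹 : FOCTVA ℓ) → Model (FOCTVA.tva 𝔹)
mainTheorem14 𝔹 = FullFunctionModel.model (FOCTVA.tva 𝔹)
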